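{- Let $m\ge 1$ be an integer and let $G$ be a graph with chromatic number $\chi(G)\le m+1$. Then for every integer $l\ge 1$, $\chi_{=}(G\circ^l K_m)=m+1$.
   Context: All graphs are finite, simple and connected. A graph is equitably $k$-colorable if its vertex set can be partitioned into $k$ (possibly empty) independent sets $V_1,\dots,V_k$ with $||V_i|-|V_j||\le 1$ for all $i,j$; the equitable chromatic number $\chi_{=}(G)$ is the least $k$ for which $G$ is equitably $k$-colorable. The corona $G\circ H$ of graphs $G$ and $H$ is the graph formed from one copy of $G$ and $|V(G)|$ copies of $H$, where the $i$-th vertex of $G$ is joined by edges to every vertex of the $i$-th copy of $H$. The $l$-corona product is defined by $G\circ^1 H=G\circ H$ and $G\circ^l H=(G\circ^{l-1}H)\circ H$ for $l\ge 2$. $K_m$ is the complete graph on $m$ vertices. -}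

module Defs where

open import Data.Nat using (ℕ; zero; suc; _+_; _*_; _≤_; _<_)
open import Data.Fin using (Fin; splitAt; remQuot)
open import Data.Fin.Properties using (_≟_)
open import Data.Bool using (Bool; true; false; not; _∧_; T)
open import Data.Sum using (_⊎_; inj₁; inj₂)
open import Data.Product using (_×_; _,_; Σ)
open import Data.List using (length; filter; allFin)
open import Relation.Nullary using (¬_; does)
open import Relation.Binary.PropositionalEquality using (_≡_)

record Graph : Set where
  constructor graph
  field
    size : ℕ
    adj  : Fin size → Fin size → Bool
open Graph public

Simple : Graph → Set
Simple G = (∀ x y → adj G x y ≡ adj G y x) × (∀ x → adj G x x ≡ false)

data Walk (G : Graph) : Fin (size G) → Fin (size G) → Set where
  here : ∀ {x} → Walk G x x
  step : ∀ {x y z} → T (adj G x y) → Walk G y z → Walk G x z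

Connected : Graph → Set
Connected G = (0 < size G) × (∀ x y → Walk G x y)

K : ℕ → Graph
K m = graph m (λ i j → not (does (i ≟ j)))

-- corona G ∘ H: vertices Fin (n + n * p); first n are G, then copy i of H
-- (vertex (i , h) via remQuot) attached to vertex i of G.
corona : Graph → Graph → Graph
corona G H = graph (n + n * p) A
  where
  n = size G
  p = size H
  A : Fin (n + n * p) → Fin (n + n * p) → Bool
  A x y with splitAt n x | splitAt n y
  ... | inj₁ a | inj₁ b = adj G a b
  ... | inj₁ a | inj₂ q with remQuot {n} p q
  ...   | (i , h) = does (a ≟ i)
  A x y | inj₂ q | inj₁ b with remQuot {n} p q
  ...   | (i , h) = does (i ≟ b)
  A x y | inj₂ q | inj₂ r with remQuot {n} p q | remQuot {n} p r
  ...   | (i , h) | (j , h') = does (i ≟ j) ∧ adj H h h'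

lcorona : Graph → Graph → ℕ → Graph
lcorona G H zero    = G
lcorona G H (suc l) = corona (lcorona G H l) H

Proper : (G : Graph) {k : ℕ} → (Fin (size G) → Fin k) → Set
Proper G c = ∀ x y → T (adj G x y) → ¬ (c x ≡ c y)

Colorable : Graph → ℕ → Set
Colorable G k = Σ (Fin (size G) → Fin k) (λ c → Proper G c)

classSize : (G : Graph) {k : ℕ} → (Fin (size G) → Fin k) → Fin k → ℕ
classSize G c i = length (filter (λ v → c v ≟ i) (allFin (size G)))

EquitablyColorable : Graph → ℕ → Set
EquitablyColorable G k =
  Σ (Fin (size G) → Fin k) (λ c → Proper G c ×
     (∀ i j → classSize G c i ≤ suc (classSize G c j)))

χ≤ : Graph → ℕ → Set
χ≤ G k = Colorable G k

EqChromaticNumberIs : Graph → ℕ → Set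
EqChromaticNumberIs G k =
  EquitablyColorable G k × (∀ j → j < k → ¬ EquitablyColorable G j)

-- Given a proper (m+1)-colouring c of G, colour the pendant copy of K m at a vertex i
-- with the m colours other than c i (via punchIn). Then i together with its copy carries
-- every colour exactly once, so every colour class of G ∘ K m has exactly |V(G)| vertices:
-- the colouring is equitable, and it is again a proper (m+1)-colouring, so it iterates.
-- Conversely each vertex with its pendant K m spans a K (m+1), which rules out fewer
-- colours by pigeonhole.
module Submission where

open import Defs
open import Data.Nat using (ℕ; zero; suc; _+_; _*_; _≤_; _<_)
open import Data.Nat.Properties
  using (+-0-commutativeMonoid; +-assoc; *-zeroʳ; *-identityʳ; n≤1+n; m≤m+n; <-≤-trans)
open import Algebra.Properties.CommutativeMonoid.Sum +-0-commutativeMonoid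
  using (sum; sum-syntax; sum-remove; ∑-distrib-+; sum-cong-≗)
open import Data.Fin using (Fin; zero; suc; splitAt; remQuot; combine; _↑ˡ_; _↑ʳ_; punchIn; fromℕ<)
open import Data.Fin.Properties
  using (_≟_; splitAt-↑ˡ; splitAt-↑ʳ; remQuot-combine; punchIn-injective; punchInᵢ≢i; pigeonhole; <⇒≢)
open import Data.Bool using (Bool; true; false; not; _∧_; T)
open import Data.Sum using (inj₁; inj₂)
open import Data.Empty using (⊥-elim)
open import Data.Product using (_,_; proj₁; proj₂)
open import Data.List using (length; filter; tabulate)
open import Function using (_∘_; id)
open import Relation.Nullary using (¬_; does; yes)
open import Relation.Nullary.Decidable using (dec-true; dec-false)
open import Relation.Unary using (Pred; Decidable)
open import Relation.Binary.PropositionalEquality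
  using (_≡_; _≢_; refl; sym; trans; cong; cong₂; subst; module ≡-Reasoning)

indicator : Bool → ℕ
indicator true  = 1
indicator false = 0

sum-const : ∀ n x → ∑[ i < n ] x ≡ n * x
sum-const zero    x = refl
sum-const (suc n) x = cong (x +_) (sum-const n x)

sum-↑ˡ-↑ʳ : ∀ m n (f : Fin (m + n) → ℕ) → sum f ≡ sum (f ∘ (_↑ˡ n)) + sum (f ∘ (m ↑ʳ_))
sum-↑ˡ-↑ʳ zero    n f = refl
sum-↑ˡ-↑ʳ (suc m) n f =
  trans (cong (f zero +_) (sum-↑ˡ-↑ʳ m n (f ∘ suc))) (sym (+-assoc (f zero) _ _))

sum-combine : ∀ m n (f : Fin (m * n) → ℕ) → sum f ≡ ∑[ i < m ] ∑[ j < n ] f (combine i j)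
sum-combine zero    n f = refl
sum-combine (suc m) n f =
  trans (sum-↑ˡ-↑ʳ n (m * n) f) (cong (sum (f ∘ (_↑ˡ m * n)) +_) (sum-combine m n (f ∘ (n ↑ʳ_))))

sum-indicator-≡ : ∀ {n} (k : Fin n) → ∑[ i < n ] indicator (does (i ≟ k)) ≡ 1
sum-indicator-≡ {suc n} zero    = cong suc (trans (sum-const n 0) (*-zeroʳ n))
sum-indicator-≡ {suc n} (suc k) = sum-indicator-≡ k

indicator-punchIn : ∀ {m} (p k : Fin (suc m)) →
  indicator (does (p ≟ k)) + ∑[ j < m ] indicator (does (punchIn p j ≟ k)) ≡ 1
indicator-punchIn p k =
  trans (sym (sum-remove {i = p} (λ i → indicator (does (i ≟ k))))) (sum-indicator-≡ k)

length-filter-tabulate : ∀ {a p n} {A : Set a} {P : Pred A p} (P? : Decidable P) (f : Fin n → A) →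
  length (filter P? (tabulate f)) ≡ ∑[ i < n ] indicator (does (P? (f i)))
length-filter-tabulate {n = zero}  P? f = refl
length-filter-tabulate {n = suc n} P? f with does (P? (f zero))
... | true  = cong suc (length-filter-tabulate P? (f ∘ suc))
... | false = length-filter-tabulate P? (f ∘ suc)

classSize-sum : ∀ (G : Graph) {k} (c : Fin (size G) → Fin k) i →
  classSize G c i ≡ ∑[ v < size G ] indicator (does (c v ≟ i))
classSize-sum G c i = length-filter-tabulate (λ v → c v ≟ i) id

equitable-if-classSize-const : ∀ (G : Graph) {k} (c : Fin (size G) → Fin k) s →
  (∀ i → classSize G c i ≡ s) → ∀ i j → classSize G c i ≤ suc (classSize G c j)
equitable-if-classSize-const G c s size≡s i j rewrite size≡s i | size≡s j = n≤1+n s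

clique⇒¬Colorable : ∀ (G : Graph) {k j} (f : Fin k → Fin (size G)) →
  (∀ u v → u ≢ v → T (adj G (f u) (f v))) → j < k → ¬ Colorable G j
clique⇒¬Colorable G f clique j<k (c , proper)
  with u , v , u<v , cu≡cv ← pigeonhole j<k (c ∘ f)
  = proper (f u) (f v) (clique u v (<⇒≢ u<v)) cu≡cv

K-proper : ∀ m → Proper (K m) id
K-proper m i j ij i≡j = subst (T ∘ not) (dec-true (i ≟ j) i≡j) ij

module _ (G H : Graph) where
  private
    n = size G
    p = size H

  base : Fin n → Fin (size (corona G H))
  base a = a ↑ˡ (n * p)

  pendant : Fin n → Fin p → Fin (size (corona G H))
  pendant i h = n ↑ʳ combine i h

  adj-base-pendant : ∀ a i h → adj (corona G H) (base a) (pendant i h) ≡ does (a ≟ i)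
  adj-base-pendant a i h
    rewrite splitAt-↑ˡ n a (n * p) | splitAt-↑ʳ n (n * p) (combine {n} {p} i h)
    = cong (λ r → does (a ≟ proj₁ r)) (remQuot-combine {n} {p} i h)

  adj-pendant-base : ∀ i h b → adj (corona G H) (pendant i h) (base b) ≡ does (i ≟ b)
  adj-pendant-base i h b
    rewrite splitAt-↑ˡ n b (n * p) | splitAt-↑ʳ n (n * p) (combine {n} {p} i h)
    = cong (λ r → does (proj₁ r ≟ b)) (remQuot-combine {n} {p} i h)

  adj-pendant-pendant : ∀ i h j h′ →
    adj (corona G H) (pendant i h) (pendant j h′) ≡ does (i ≟ j) ∧ adj H h h′
  adj-pendant-pendant i h j h′
    rewrite splitAt-↑ʳ n (n * p) (combine {n} {p} i h) | splitAt-↑ʳ n (n * p) (combine {n} {p} j h′)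
    = cong₂ (λ r s → does (proj₁ r ≟ proj₁ s) ∧ adj H (proj₂ r) (proj₂ s))
            (remQuot-combine {n} {p} i h) (remQuot-combine {n} {p} j h′)

  coronaColouring : ∀ {k} → (Fin n → Fin (suc k)) → (Fin p → Fin k) →
    Fin (size (corona G H)) → Fin (suc k)
  coronaColouring c d x with splitAt n x
  ... | inj₁ a = c a
  ... | inj₂ q = let i , h = remQuot {n} p q in punchIn (c i) (d h)

  coronaColouring-base : ∀ {k} (c : Fin n → Fin (suc k)) d a → coronaColouring c d (base a) ≡ c a
  coronaColouring-base c d a rewrite splitAt-↑ˡ n a (n * p) = refl

  coronaColouring-pendant : ∀ {k} (c : Fin n → Fin (suc k)) d i h →
    coronaColouring c d (pendant i h) ≡ punchIn (c i) (d h)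
  coronaColouring-pendant c d i h
    rewrite splitAt-↑ʳ n (n * p) (combine {n} {p} i h)
    = cong (λ r → punchIn (c (proj₁ r)) (d (proj₂ r))) (remQuot-combine {n} {p} i h)

  coronaColouring-proper : ∀ {k} {c : Fin n → Fin (suc k)} {d : Fin p → Fin k} →
    Proper G c → Proper H d → Proper (corona G H) (coronaColouring c d)
  coronaColouring-proper {c = c} {d} properG properH x y xy with splitAt n x | splitAt n y
  ... | inj₁ a | inj₁ b = properG a b xy
  ... | inj₁ a | inj₂ q = base-pendant a (proj₁ (remQuot {n} p q)) (proj₂ (remQuot {n} p q)) xy
    where
    base-pendant : ∀ a i h → T (does (a ≟ i)) → c a ≢ punchIn (c i) (d h)
    base-pendant a i h a≡i with a ≟ i
    ... | yes refl = punchInᵢ≢i (c a) (d h) ∘ sym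
  ... | inj₂ q | inj₁ b = pendant-base (proj₁ (remQuot {n} p q)) (proj₂ (remQuot {n} p q)) b xy
    where
    pendant-base : ∀ i h b → T (does (i ≟ b)) → punchIn (c i) (d h) ≢ c b
    pendant-base i h b i≡b with i ≟ b
    ... | yes refl = punchInᵢ≢i (c i) (d h)
  ... | inj₂ q | inj₂ r =
    pendant-pendant (proj₁ (remQuot {n} p q)) (proj₂ (remQuot {n} p q))
                    (proj₁ (remQuot {n} p r)) (proj₂ (remQuot {n} p r)) xy
    where
    pendant-pendant : ∀ i h j h′ → T (does (i ≟ j) ∧ adj H h h′) →
      punchIn (c i) (d h) ≢ punchIn (c j) (d h′)
    pendant-pendant i h j h′ adjacent with i ≟ j
    ... | yes refl = properH h h′ adjacent ∘ punchIn-injective (c i) (d h) (d h′)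

classSize-coronaColouring : ∀ (G : Graph) {m} (c : Fin (size G) → Fin (suc m)) k →
  classSize (corona G (K m)) (coronaColouring G (K m) c id) k ≡ size G
classSize-coronaColouring G {m} c k = begin
  classSize (corona G (K m)) colour k
    ≡⟨ classSize-sum (corona G (K m)) colour k ⟩
  ∑[ v < n + n * m ] δ (colour v)
    ≡⟨ sum-↑ˡ-↑ʳ n (n * m) (δ ∘ colour) ⟩
  ∑[ a < n ] δ (colour (base G (K m) a)) + ∑[ q < n * m ] δ (colour (n ↑ʳ q))
    ≡⟨ cong₂ _+_ (sum-cong-≗ (cong δ ∘ coronaColouring-base G (K m) c id))
                 (sum-combine n m (δ ∘ colour ∘ (n ↑ʳ_))) ⟩
  ∑[ i < n ] δ (c i) + ∑[ i < n ] ∑[ h < m ] δ (colour (pendant G (K m) i h))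
    ≡⟨ cong (∑[ i < n ] δ (c i) +_)
            (sum-cong-≗ λ i → sum-cong-≗ (cong δ ∘ coronaColouring-pendant G (K m) c id i)) ⟩
  ∑[ i < n ] δ (c i) + ∑[ i < n ] ∑[ h < m ] δ (punchIn (c i) h)
    ≡⟨ sym (∑-distrib-+ (δ ∘ c) (λ i → ∑[ h < m ] δ (punchIn (c i) h))) ⟩
  ∑[ i < n ] (δ (c i) + ∑[ h < m ] δ (punchIn (c i) h))
    ≡⟨ sum-cong-≗ (λ i → indicator-punchIn (c i) k) ⟩
  ∑[ i < n ] 1
    ≡⟨ trans (sum-const n 1) (*-identityʳ n) ⟩
  n ∎
  where
  open ≡-Reasoning
  n = size G
  colour = coronaColouring G (K m) c id
  δ : Fin (suc m) → ℕ
  δ x = indicator (does (x ≟ k))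

pendantClique : ∀ (G : Graph) m → Fin (size G) → Fin (suc m) → Fin (size (corona G (K m)))
pendantClique G m a zero    = base G (K m) a
pendantClique G m a (suc h) = pendant G (K m) a h

pendantClique-adj : ∀ (G : Graph) m a u v → u ≢ v →
  T (adj (corona G (K m)) (pendantClique G m a u) (pendantClique G m a v))
pendantClique-adj G m a zero zero u≢v = ⊥-elim (u≢v refl)
pendantClique-adj G m a zero (suc h) _
  rewrite adj-base-pendant G (K m) a a h | dec-true (a ≟ a) refl = _
pendantClique-adj G m a (suc h) zero _
  rewrite adj-pendant-base G (K m) a h a | dec-true (a ≟ a) refl = _
pendantClique-adj G m a (suc h) (suc h′) u≢v
  rewrite adj-pendant-pendant G (K m) a h a h′ | dec-true (a ≟ a) refl
        | dec-false (h ≟ h′) (u≢v ∘ cong suc) = _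

lcorona-colorable : ∀ (G : Graph) m → Colorable G (suc m) → ∀ l → Colorable (lcorona G (K m) l) (suc m)
lcorona-colorable G m colorable zero = colorable
lcorona-colorable G m colorable (suc l) =
  let c , proper = lcorona-colorable G m colorable l
  in coronaColouring (lcorona G (K m) l) (K m) c id , coronaColouring-proper _ _ proper (K-proper m)

lcorona-nonempty : ∀ (G H : Graph) → 0 < size G → ∀ l → 0 < size (lcorona G H l)
lcorona-nonempty G H nonempty zero    = nonempty
lcorona-nonempty G H nonempty (suc l) = <-≤-trans (lcorona-nonempty G H nonempty l) (m≤m+n _ _)

proposition1 : (m : ℕ) → 1 ≤ m → (G : Graph) → Simple G → Connected G →
    χ≤ G (suc m) → (l : ℕ) → 1 ≤ l →
    EqChromaticNumberIs (lcorona G (K m) l) (suc m)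
proposition1 m _ G _ (nonempty , _) colorable (suc l) _ =
  (colour , coronaColouring-proper H (K m) proper (K-proper m) ,
   equitable-if-classSize-const (corona H (K m)) colour (size H) (classSize-coronaColouring H c))
  , λ j j<1+m (d , properD , _) →
      clique⇒¬Colorable (corona H (K m)) (pendantClique H m vertex) (pendantClique-adj H m vertex) j<1+m
        (d , properD)
  where
  H = lcorona G (K m) l
  c = proj₁ (lcorona-colorable G m colorable l)
  proper = proj₂ (lcorona-colorable G m colorable l)
  colour = coronaColouring H (K m) c id
  vertex = fromℕ< (lcorona-nonempty G (K m) nonempty l)
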